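{- Let $G$ be a connected graph such that $\mathcal{N}_m(G)\neq\emptyset$ for some positive integer $m$ and $\eta(G)\le\left\lfloor\frac{diam(G)-2}{4}\right\rfloor$. Then $Dim(G)=\eta(G)$.
   Context: Graphs are simple and connected; $d$ is the shortest-path distance, $diam(G)$ the diameter. A set $S\subseteq V(G)$ is a $k$-metric generator if for every pair of distinct vertices $u,v$ there are at least $k$ vertices $w\in S$ with $d(u,w)\neq d(v,w)$; $Dim(G)=k$ means $k$ is the largest integer such that a $k$-metric generator exists. For a vertex $v$ and positive integer $m$: $N(v,m)=\{w: d(v,w)\le m\}$, $S(v,m)=\{w: d(v,w)=m\}$, $\partial N(v,m)=\{w\in S(v,m): d(w,V(G)\setminus N(v,m))=1\}$. Distinct $v,v'$ have equal $m$-boundary if $\partial N(v,m)=\partial N(v',m)\neq\emptyset$; $\mathcal{N}_m(G)$ is the set of such ordered pairs. For $(v,v')\in\mathcal{N}_m(G)$, $\eta_m(v,v')=|\{w\in N(v,m)\cup N(v',m): d(v,w)\neq d(v',w)\}|$; $\eta_m(G)=\min_{(v,v')\in\mathcal{N}_m(G)}\eta_m(v,v')$ and $\eta(G)=\min_m\eta_m(G)$ (over those $m$ with $\mathcal{N}_m(G)\neq\emptyset$). -}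

module Defs where

open import Data.Nat using (ℕ; zero; suc; _≤_; _<_; _⊔_; _≤?_)
open import Data.Bool using (Bool; true; false; _∨_; _∧_; if_then_else_)
open import Data.Fin using (Fin; _≟_)
open import Data.Fin.Subset using (Subset; _∈_)
open import Data.Fin.Subset.Properties using (_∈?_)
open import Data.Bool.ListAction using (any)
open import Data.List using (List; filter; length; map; foldr; allFin; concatMap)
open import Data.Product using (Σ; ∃; _×_; _,_)
open import Data.Sum using (_⊎_)
open import Relation.Nullary using (¬_; Dec; yes; no; ⌊_⌋)
open import Relation.Nullary.Decidable using (_×-dec_; _⊎-dec_; ¬?)
open import Relation.Binary.PropositionalEquality using (_≡_; _≢_)
import Data.Nat.Properties as ℕP

record Graph (n : ℕ) : Set where
  field
    adj     : Fin n → Fin n → Bool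
    adj-sym : ∀ u v → adj u v ≡ adj v u
    irrefl  : ∀ v → adj v v ≡ false
open Graph public

module _ {n : ℕ} (G : Graph n) where

  reach : ℕ → Fin n → Fin n → Bool
  reach zero    u v = ⌊ u ≟ v ⌋
  reach (suc k) u v = reach k u v ∨ any (λ w → reach k u w ∧ adj G w v) (allFin n)

  Connected : Set
  Connected = ∀ u v → ∃ λ k → reach k u v ≡ true

-- least i ≤ b with p i = true (returns b if there is none)
least : (ℕ → Bool) → ℕ → ℕ
least p zero    = zero
least p (suc b) = if p zero then zero else suc (least (λ i → p (suc i)) b)

module _ {n : ℕ} (G : Graph n) where

  -- shortest-path distance: the least k with a walk of length ≤ k
  -- (any shortest walk has length < n; for connected G this is d(u,v)).
  dist : Fin n → Fin n → ℕ
  dist u v = least (λ k → reach G k u v) n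

  diam : ℕ
  diam = foldr _⊔_ 0 (concatMap (λ u → map (λ v → dist u v) (allFin n)) (allFin n))

  count : {P : Fin n → Set} → (∀ w → Dec (P w)) → ℕ
  count P? = length (filter P? (allFin n))

  resolvers : Subset n → Fin n → Fin n → ℕ
  resolvers S u v =
    count (λ w → (w ∈? S) ×-dec ¬? (dist u w ℕP.≟ dist v w))

  IsKMetricGenerator : ℕ → Subset n → Set
  IsKMetricGenerator k S = ∀ u v → u ≢ v → k ≤ resolvers S u v

  IsDim : ℕ → Set
  IsDim k = (∃ λ S → IsKMetricGenerator k S)
          × (∀ k′ → k < k′ → ¬ (∃ λ S → IsKMetricGenerator k′ S))

  -- w ∈ ∂N(v,m):  d(v,w) = m  and  d(w, V ∖ N(v,m)) = 1,
  -- i.e. w has a vertex x with d(v,x) > m at distance 1.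
  InBoundary : Fin n → ℕ → Fin n → Set
  InBoundary v m w = dist v w ≡ m × ∃ λ x → m < dist v x × dist w x ≡ 1

  EqualBoundary : ℕ → Fin n → Fin n → Set
  EqualBoundary m v v′ =
    v ≢ v′
    × (∀ w → (InBoundary v m w → InBoundary v′ m w) × (InBoundary v′ m w → InBoundary v m w))
    × ∃ (λ w → InBoundary v m w)

  etaPair : ℕ → Fin n → Fin n → ℕ
  etaPair m v v′ =
    count (λ w → ((dist v w ≤? m) ⊎-dec (dist v′ w ≤? m)) ×-dec ¬? (dist v w ℕP.≟ dist v′ w))

  NmNonempty : ℕ → Set
  NmNonempty m = ∃ λ v → ∃ λ v′ → EqualBoundary m v v′

  IsEta : ℕ → Set
  IsEta e = (∃ λ m → 1 ≤ m × ∃ λ v → ∃ λ v′ → EqualBoundary m v v′ × etaPair m v v′ ≡ e)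
          × (∀ m v v′ → 1 ≤ m → EqualBoundary m v v′ → e ≤ etaPair m v v′)

-- If (v,v′) has equal m-boundary, a vertex w outside N(v,m) ∪ N(v′,m) is reached from both v
-- and v′ through a common boundary vertex, so d(v,w) = d(v′,w): only the η_m(v,v′) vertices of
-- N(v,m) ∪ N(v′,m) can resolve v and v′, and no k-metric generator has k > η(G).
-- Conversely, let K be the number of vertices resolving u ≠ v. A geodesic from u to a vertex x
-- closer to u than to v consists of such vertices, at distinct distances from u, so d(u,x) < K;
-- applied to both halves of a u–v geodesic this also gives d(u,v) ≤ K. Hence u and v agree on
-- every vertex farther than 2K from either. If some vertex is farther than 2K+1 from u, then
-- u, v have equal (2K+1)-boundary and η(G) ≤ K; otherwise diam(G) ≤ 4K+2, and the hypothesis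
-- η(G) ≤ ⌊(diam(G)−2)/4⌋ again gives η(G) ≤ K. So V(G) itself is an η(G)-metric generator.

module Submission where

open import Defs
open import Data.Bool using (Bool; true; false; T)
open import Data.Bool.Properties using (T-∨; T-∧; T-≡)
open import Data.Nat using (ℕ; zero; suc; _+_; _*_; _∸_; _≤_; _<_; _⊔_; z≤n; s≤s)
open import Data.Nat.Properties
open import Data.Nat.DivMod using (m/n*n≤m)
open import Data.Integer using (+_; _-_; _/ℕ_; +≤+) renaming (_≤_ to _≤ℤ_)
open import Data.Nat.Tactic.RingSolver using (solve-∀)
open import Algebra.Properties.CommutativeSemigroup +-commutativeSemigroup
  using () renaming (interchange to +-interchange)
open import Data.Fin using (Fin)
open import Data.Fin.Properties using (any?)
open import Data.Fin.Subset using (⊤)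
open import Data.Fin.Subset.Properties using (∈⊤)
open import Data.List using (List; []; _∷_; filter; length; map; allFin)
open import Data.List.Properties using (length-filter; length-tabulate; foldr-preservesᵇ)
import Data.List.Relation.Unary.All as All
import Data.List.Relation.Unary.All.Properties as All
open import Data.List.Membership.Propositional using (_∈_)
open import Data.List.Membership.Propositional.Properties using (∈-allFin; ∈-filter⁺; ∈-length)
open import Data.List.Relation.Unary.Any as Any using (here; there)
open import Data.List.Relation.Unary.Any.Properties using (any⁺; any⁻)
open import Data.List.Relation.Binary.Sublist.Propositional using (⊆-refl)
open import Data.List.Relation.Binary.Sublist.Propositional.Properties using (filter⁺; length-mono-≤)
open import Data.Product using (∃; _×_; _,_; proj₁; proj₂; map₂)
open import Data.Sum using (_⊎_; inj₁; inj₂)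
open import Data.Empty using (⊥-elim)
open import Function using (Equivalence; id; _∘_; case_of_)
open import Relation.Nullary using (¬_; yes; no; ¬?; contradiction; decidable-stable)
open import Relation.Nullary.Decidable using (_×-dec_; T?; toWitness; fromWitness)
open import Relation.Unary using (Decidable)
open import Relation.Binary.PropositionalEquality
open import Relation.Binary.Definitions using (tri<; tri≈; tri>)

module _ {A : Set} where

  length-filter-mono : {P Q : A → Set} (P? : Decidable P) (Q? : Decidable Q) →
    (∀ {x} → P x → Q x) → ∀ xs → length (filter P? xs) ≤ length (filter Q? xs)
  length-filter-mono P? Q? P⇒Q xs = length-mono-≤ (filter⁺ P? Q? (λ { refl → P⇒Q }) (⊆-refl {x = xs}))

  length-filter-mono-< : {P Q : A → Set} (P? : Decidable P) (Q? : Decidable Q) →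
    (∀ {x} → P x → Q x) → ∀ {y xs} → y ∈ xs → Q y → ¬ P y →
    length (filter P? xs) < length (filter Q? xs)
  length-filter-mono-< P? Q? P⇒Q {y} {x ∷ xs} (here refl) qy ¬py with P? x | Q? x
  ... | yes px | _     = contradiction px ¬py
  ... | no _   | no ¬q = contradiction qy ¬q
  ... | no _   | yes _ = s≤s (length-filter-mono P? Q? P⇒Q xs)
  length-filter-mono-< P? Q? P⇒Q {y} {x ∷ xs} (there y∈xs) qy ¬py
    with ih ← length-filter-mono-< P? Q? P⇒Q y∈xs qy ¬py | P? x | Q? x
  ... | yes px | no ¬qx = contradiction (P⇒Q px) ¬qx
  ... | yes _  | yes _  = s≤s ih
  ... | no _   | yes _  = m≤n⇒m≤1+n ih
  ... | no _   | no _   = ih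

  length-filter-disjoint-+ : {P Q R : A → Set} (P? : Decidable P) (Q? : Decidable Q) (R? : Decidable R) →
    (∀ {x} → P x → ¬ Q x) → (∀ {x} → P x → R x) → (∀ {x} → Q x → R x) → ∀ xs →
    length (filter P? xs) + length (filter Q? xs) ≤ length (filter R? xs)
  length-filter-disjoint-+ P? Q? R? P⇒¬Q P⇒R Q⇒R [] = z≤n
  length-filter-disjoint-+ P? Q? R? P⇒¬Q P⇒R Q⇒R (x ∷ xs)
    with ih ← length-filter-disjoint-+ P? Q? R? P⇒¬Q P⇒R Q⇒R xs | P? x | Q? x | R? x
  ... | yes p | yes q | _     = contradiction q (P⇒¬Q p)
  ... | yes p | no _  | no ¬r = contradiction (P⇒R p) ¬r
  ... | no _  | yes q | no ¬r = contradiction (Q⇒R q) ¬r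
  ... | yes _ | no _  | yes _ = s≤s ih
  ... | no _  | yes _ | yes _ = subst (_≤ suc (length (filter R? xs))) (sym (+-suc _ _)) (s≤s ih)
  ... | no _  | no _  | yes _ = m≤n⇒m≤1+n ih
  ... | no _  | no _  | no _  = ih

  length-filter-≥-values : {P : A → Set} (P? : Decidable P) (g : A → ℕ) (xs : List A) (N : ℕ) →
    (∀ {i} → i < N → ∃ λ y → y ∈ xs × P y × g y ≡ i) → N ≤ length (filter P? xs)
  length-filter-≥-values {P} P? g xs N values =
    ≤-trans (below N values) (length-filter-mono _ P? proj₁ xs)
    where
    below : ∀ N → (∀ {i} → i < N → ∃ λ y → y ∈ xs × P y × g y ≡ i) →
            N ≤ length (filter (λ y → P? y ×-dec (g y <? N)) xs)
    below zero    _      = z≤n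
    below (suc N) values with values ≤-refl
    ... | y , y∈xs , py , gy≡N = ≤-trans (s≤s (below N (values ∘ m≤n⇒m≤1+n)))
      (length-filter-mono-< _ _ (λ (p , lt) → p , m≤n⇒m≤1+n lt) y∈xs (py , s≤s (≤-reflexive gy≡N))
        (λ (_ , lt) → <-irrefl gy≡N lt))

least-minimal : ∀ (p : ℕ → Bool) b {i} → T (p i) → least p b ≤ i
least-minimal p zero    _ = z≤n
least-minimal p (suc b) {i} pi with p zero in eq
... | true  = z≤n
least-minimal p (suc b) {zero}  pi | false = ⊥-elim (subst T eq pi)
least-minimal p (suc b) {suc i} pi | false = s≤s (least-minimal (p ∘ suc) b pi)

least-satisfies : ∀ (p : ℕ → Bool) b → T (p b) → T (p (least p b))
least-satisfies p zero    pb = pb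
least-satisfies p (suc b) pb with p zero in eq
... | true  = subst T (sym eq) _
... | false = least-satisfies (p ∘ suc) b pb

m*4+2≤[1+n+n]+[1+n+n]⇒m≤n : ∀ {m n} → m * 4 + 2 ≤ suc (n + n) + suc (n + n) → m ≤ n
m*4+2≤[1+n+n]+[1+n+n]⇒m≤n {m} {n} le =
  *-cancelʳ-≤ m n 4 (+-cancelʳ-≤ 2 (m * 4) (n * 4) (subst (m * 4 + 2 ≤_) (normalise n) le))
  where
  normalise : ∀ n → suc (n + n) + suc (n + n) ≡ n * 4 + 2
  normalise = solve-∀

-- For n < 2 the bound (+ n - + 2) /ℕ 4 is negative, so those cases are absurd.
+m≤[+n-2]/4⇒m*4+2≤n : ∀ {m} n → + m ≤ℤ (+ n - + 2) /ℕ 4 → m * 4 + 2 ≤ n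
+m≤[+n-2]/4⇒m*4+2≤n {m} (suc (suc n)) (+≤+ m≤n/4) = subst (_≤ 2 + n) (+-comm 2 (m * 4))
  (+-monoʳ-≤ 2 (≤-trans (*-monoˡ-≤ 4 m≤n/4) (m/n*n≤m n 4)))

-- Reachability

module Reachability {n : ℕ} (G : Graph n) where

  -- A record rather than T (reach G k u v), so that k, u and v can be inferred.
  record Reach (k : ℕ) (u v : Fin n) : Set where
    constructor reach⁺
    field reach⁻ : T (reach G k u v)
  open Reach

  reach-refl : ∀ {u} → Reach 0 u u
  reach-refl = reach⁺ (fromWitness refl)

  reach-zero⁻ : ∀ {u v} → Reach 0 u v → u ≡ v
  reach-zero⁻ r = toWitness (reach⁻ r)

  reach-suc : ∀ {k u v} → Reach k u v → Reach (suc k) u v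
  reach-suc r = reach⁺ (Equivalence.from T-∨ (inj₁ (reach⁻ r)))

  reach-step : ∀ {k u x v} → Reach k u x → T (adj G x v) → Reach (suc k) u v
  reach-step {x = x} r xv = reach⁺ (Equivalence.from T-∨ (inj₂ (any⁺ _ (Any.map
    (λ { refl → Equivalence.from T-∧ (reach⁻ r , xv) }) (∈-allFin x)))))

  reach-suc⁻ : ∀ {k u v} → Reach (suc k) u v → Reach k u v ⊎ ∃ λ x → Reach k u x × T (adj G x v)
  reach-suc⁻ (reach⁺ r) with Equivalence.to T-∨ r
  ... | inj₁ r′ = inj₁ (reach⁺ r′)
  ... | inj₂ a  with x , step ← Any.satisfied (any⁻ _ (allFin n) a)
                with r′ , xv ← Equivalence.to T-∧ step = inj₂ (x , reach⁺ r′ , xv)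

  reach-+ˡ : ∀ o {k u v} → Reach k u v → Reach (o + k) u v
  reach-+ˡ zero    r = r
  reach-+ˡ (suc o) r = reach-suc (reach-+ˡ o r)

  reach-mono : ∀ {k j u v} → k ≤ j → Reach k u v → Reach j u v
  reach-mono {k} {j} {u} {v} k≤j r = subst (λ i → Reach i u v) (m∸n+n≡m k≤j) (reach-+ˡ (j ∸ k) r)

  reach-trans : ∀ {a} b {u v w} → Reach a u v → Reach b v w → Reach (a + b) u w
  reach-trans {a} zero {u} r s with refl ← reach-zero⁻ s = subst (λ k → Reach k u _) (sym (+-identityʳ a)) r
  reach-trans {a} (suc b) {u} {w = w} r s = subst (λ k → Reach k u w) (sym (+-suc a b)) (extend (reach-suc⁻ s))
    where
    extend : _ → Reach (suc (a + b)) u w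
    extend (inj₁ s′)            = reach-suc (reach-trans b r s′)
    extend (inj₂ (x , s′ , xw)) = reach-step (reach-trans b r s′) xw

  reach-sym : ∀ {k u v} → Reach k u v → Reach k v u
  reach-sym {zero}  r with refl ← reach-zero⁻ r = r
  reach-sym {suc k} r with reach-suc⁻ r
  ... | inj₁ r′            = reach-suc (reach-sym r′)
  ... | inj₂ (x , r′ , xv) = reach-trans k (reach-step reach-refl (subst T (adj-sym G _ _) xv)) (reach-sym r′)

  -- The vertices within k steps of u grow strictly with k until they stop growing for good;
  -- there are at most n of them, so every vertex reachable from u is reachable in n steps.
  module _ (u : Fin n) where

    reachedCount : ℕ → ℕ
    reachedCount k = count G (λ v → T? (reach G k u v))

    StableAt : ℕ → Set
    StableAt k = ∀ {v} → Reach (suc k) u v → Reach k u v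

    stable-forever : ∀ {k} → StableAt k → ∀ j {v} → Reach (j + k) u v → Reach k u v
    stable-forever st zero    r = r
    stable-forever st (suc j) r with reach-suc⁻ r
    ... | inj₁ r′            = stable-forever st j r′
    ... | inj₂ (x , r′ , xv) = st (reach-step (stable-forever st j r′) xv)

    stable-or-growing : ∀ k → StableAt k ⊎ reachedCount k < reachedCount (suc k)
    stable-or-growing k with any? (λ v → T? (reach G (suc k) u v) ×-dec ¬? (T? (reach G k u v)))
    ... | yes (v , r , ¬r) =
      inj₂ (length-filter-mono-< _ _ (λ r′ → reach⁻ (reach-suc (reach⁺ {k} r′))) (∈-allFin v) r ¬r)
    ... | no none = inj₁ λ {v} r →
      reach⁺ (decidable-stable (T? _) λ ¬r → none (v , reach⁻ r , ¬r))

    stable-by-or-growing-past : ∀ k → (∃ λ j → j ≤ k × StableAt j) ⊎ k < reachedCount k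
    stable-by-or-growing-past zero =
      inj₂ (∈-length (∈-filter⁺ (λ v → T? (reach G 0 u v)) (∈-allFin u) (reach⁻ reach-refl)))
    stable-by-or-growing-past (suc k) with stable-by-or-growing-past k
    ... | inj₁ (j , j≤k , st) = inj₁ (j , m≤n⇒m≤1+n j≤k , st)
    ... | inj₂ k<count with stable-or-growing k
    ...   | inj₁ st          = inj₁ (k , n≤1+n k , st)
    ...   | inj₂ count<count = inj₂ (≤-trans (s≤s k<count) count<count)

    reach-within-vertex-count : ∀ {k v} → Reach k u v → Reach n u v
    reach-within-vertex-count {k} r with stable-by-or-growing-past n
    ... | inj₁ (j , j≤n , st) = reach-mono j≤n (stable-forever st k (reach-mono (m≤m+n k j) r))
    ... | inj₂ n<count = contradiction
      (≤-trans (length-filter _ (allFin n)) (≤-reflexive (length-tabulate id))) (<⇒≱ n<count)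

-- Distances

diam-lub : ∀ {n} (G : Graph n) {C} → (∀ u v → dist G u v ≤ C) → diam G ≤ C
diam-lub {n} G {C} bound = foldr-preservesᵇ {P = _≤ C} {f = _⊔_} ⊔-lub z≤n
  (All.concat⁺ (All.map⁺ {xs = allFin n} {f = λ u → map (dist G u) (allFin n)}
    (All.tabulate λ {u} _ → All.map⁺ (All.tabulate λ {v} _ → bound u v))))

module Distance {n : ℕ} (G : Graph n) (connected : Connected G) where
  open Reachability G

  private
    d : Fin n → Fin n → ℕ
    d = dist G

  reach-dist : ∀ u v → Reach (d u v) u v
  reach-dist u v with k , r ← connected u v = reach⁺ (least-satisfies (λ k → reach G k u v) n
    (Reach.reach⁻ (reach-within-vertex-count u (reach⁺ {k} (Equivalence.from T-≡ r)))))

  dist-minimal : ∀ {k u v} → Reach k u v → d u v ≤ k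
  dist-minimal {u = u} {v} r = least-minimal (λ k → reach G k u v) n (Reach.reach⁻ r)

  dist-refl : ∀ u → d u u ≡ 0
  dist-refl u = n≤0⇒n≡0 (dist-minimal reach-refl)

  dist-triangle : ∀ u v w → d u w ≤ d u v + d v w
  dist-triangle u v w = dist-minimal (reach-trans (d v w) (reach-dist u v) (reach-dist v w))

  dist-sym : ∀ u v → d u v ≡ d v u
  dist-sym u v = ≤-antisym (dist-minimal (reach-sym (reach-dist v u))) (dist-minimal (reach-sym (reach-dist u v)))

  dist-predecessor : ∀ {u w t} → d u w ≡ suc t → ∃ λ x → d u x ≡ t × d x w ≤ 1
  dist-predecessor {u} {w} {t} uw≡1+t with reach-suc⁻ (subst (λ k → Reach k u w) uw≡1+t (reach-dist u w))
  ... | inj₁ r = contradiction (≤-trans (≤-reflexive (sym uw≡1+t)) (dist-minimal r)) (n≮n t)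
  ... | inj₂ (x , r , xw) = x , ≤-antisym (dist-minimal r) t≤ux , xw≤1
    where
    xw≤1 : d x w ≤ 1
    xw≤1 = dist-minimal (reach-step reach-refl xw)
    t≤ux : t ≤ d u x
    t≤ux = +-cancelʳ-≤ 1 t (d u x) (begin
      t + 1           ≡⟨ +-comm t 1 ⟩
      suc t           ≡⟨ sym uw≡1+t ⟩
      d u w           ≤⟨ dist-triangle u x w ⟩
      d u x + d x w   ≤⟨ +-monoʳ-≤ (d u x) xw≤1 ⟩
      d u x + 1       ∎)
      where open ≤-Reasoning

  geodesic-vertex : ∀ u w i j → i + j ≡ d u w → ∃ λ x → d u x ≡ i × d x w ≡ j
  geodesic-vertex u w i zero i+0≡uw = w , trans (sym i+0≡uw) (+-identityʳ i) , dist-refl w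
  geodesic-vertex u w i (suc j) i+1+j≡uw
    with y , uy , yw ← geodesic-vertex u w (suc i) j (trans (sym (+-suc i j)) i+1+j≡uw)
    with x , ux , xy≤1 ← dist-predecessor uy
    = x , ux , ≤-antisym xw≤1+j 1+j≤xw
    where
    xw≤1+j : d x w ≤ suc j
    xw≤1+j = ≤-trans (dist-triangle x y w) (+-mono-≤ xy≤1 (≤-reflexive yw))
    1+j≤xw : suc j ≤ d x w
    1+j≤xw = +-cancelˡ-≤ i (suc j) (d x w)
      (subst₂ _≤_ (sym i+1+j≡uw) (cong (_+ d x w) ux) (dist-triangle u x w))

  boundary-vertex-towards : ∀ {u z m} → m < d u z → ∃ λ x → InBoundary G u m x × m + d x z ≤ d u z
  boundary-vertex-towards {u} {z} {m} m<uz
    with y , uy , yz ← geodesic-vertex u z (suc m) (d u z ∸ suc m) (m+[n∸m]≡n m<uz)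
    with x , ux , xy≤1 ← dist-predecessor uy
    = x , (ux , y , ≤-reflexive (sym uy) , ≤-antisym xy≤1 1≤xy) , m+xz≤uz
    where
    1≤xy : 1 ≤ d x y
    1≤xy = +-cancelˡ-≤ m 1 (d x y) (begin
      m + 1         ≡⟨ +-comm m 1 ⟩
      suc m         ≡⟨ sym uy ⟩
      d u y         ≤⟨ dist-triangle u x y ⟩
      d u x + d x y ≡⟨ cong (_+ d x y) ux ⟩
      m + d x y     ∎)
      where open ≤-Reasoning
    m+xz≤uz : m + d x z ≤ d u z
    m+xz≤uz = begin
      m + d x z                ≤⟨ +-monoʳ-≤ m (dist-triangle x y z) ⟩
      m + (d x y + d y z)      ≤⟨ +-monoʳ-≤ m (+-monoˡ-≤ (d y z) xy≤1) ⟩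
      m + suc (d y z)          ≡⟨ +-suc m (d y z) ⟩
      suc m + d y z            ≡⟨ cong (λ k → suc m + k) yz ⟩
      suc m + (d u z ∸ suc m)  ≡⟨ m+[n∸m]≡n m<uz ⟩
      d u z                    ∎
      where open ≤-Reasoning

  diam-≤-eccentricity : ∀ {u r} → (∀ x → d u x ≤ r) → diam G ≤ r + r
  diam-≤-eccentricity {u} ecc = diam-lub G λ x y →
    ≤-trans (dist-triangle x u y) (+-mono-≤ (subst (_≤ _) (dist-sym u x) (ecc x)) (ecc y))

  -- Equal boundaries

  dist-≤-via-boundary : ∀ {a b m w} → (∀ {x} → InBoundary G a m x → InBoundary G b m x) →
                        m < d a w → d b w ≤ d a w
  dist-≤-via-boundary {a} {b} {m} {w} ∂a⊆∂b m<aw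
    with x , x∈∂a , m+xw≤aw ← boundary-vertex-towards m<aw
    = ≤-trans (dist-triangle b x w)
        (subst (λ k → k + d x w ≤ d a w) (sym (proj₁ (∂a⊆∂b x∈∂a))) m+xw≤aw)

  equalBoundary-agree-outside : ∀ {m v v′ w} → EqualBoundary G m v v′ →
                                m < d v w → m < d v′ w → d v w ≡ d v′ w
  equalBoundary-agree-outside (_ , ∂v≡∂v′ , _) m<vw m<v′w =
    ≤-antisym (dist-≤-via-boundary (proj₂ (∂v≡∂v′ _)) m<v′w)
              (dist-≤-via-boundary (proj₁ (∂v≡∂v′ _)) m<vw)

  equalBoundary-resolved-within : ∀ {m v v′ w} → EqualBoundary G m v v′ →
                                  d v w ≢ d v′ w → d v w ≤ m ⊎ d v′ w ≤ m
  equalBoundary-resolved-within {m} {v} {v′} {w} eb vw≢v′w with d v w ≤? m | d v′ w ≤? m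
  ... | yes vw≤m | _        = inj₁ vw≤m
  ... | no _     | yes v′w≤m = inj₂ v′w≤m
  ... | no vw≰m  | no v′w≰m  =
    contradiction (equalBoundary-agree-outside eb (≰⇒> vw≰m) (≰⇒> v′w≰m)) vw≢v′w

  generator-≤-etaPair : ∀ {m v v′ k S} → EqualBoundary G m v v′ →
                        IsKMetricGenerator G k S → k ≤ etaPair G m v v′
  generator-≤-etaPair {v = v} {v′} eb S-generates = ≤-trans (S-generates v v′ (proj₁ eb))
    (length-filter-mono _ _ (λ (_ , vw≢v′w) → equalBoundary-resolved-within eb vw≢v′w , vw≢v′w) (allFin n))

  -- Resolving counts

  closerCount : Fin n → Fin n → ℕ
  closerCount u v = count G (λ w → d u w <? d v w)

  resolvingCount : Fin n → Fin n → ℕ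
  resolvingCount u v = count G (λ w → ¬? (d u w ≟ d v w))

  dist<closerCount : ∀ {u v x} → d u x < d v x → d u x < closerCount u v
  dist<closerCount {u} {v} {x} ux<vx = length-filter-≥-values _ (d u) (allFin n) (suc (d u x)) on-geodesic
    where
    on-geodesic : ∀ {i} → i < suc (d u x) → ∃ λ y → y ∈ allFin n × d u y < d v y × d u y ≡ i
    on-geodesic (s≤s i≤ux) with y , uy , yx ← geodesic-vertex u x _ _ (m+[n∸m]≡n i≤ux) =
      y , ∈-allFin y , +-cancelʳ-< (d y x) (d u y) (d v y) (begin-strict
        d u y + d y x  ≡⟨ cong₂ _+_ uy yx ⟩
        _              ≡⟨ m+[n∸m]≡n i≤ux ⟩
        d u x          <⟨ ux<vx ⟩
        d v x          ≤⟨ dist-triangle v y x ⟩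
        d v y + d y x  ∎) , uy
      where open ≤-Reasoning

  dist≤closerCount+closerCount : ∀ u v → d u v ≤ closerCount u v + closerCount u v
  dist≤closerCount+closerCount u v = ≮⇒≥ λ c+c<uv →
    let c≤uv = ≤-trans (m≤m+n c c) (<⇒≤ c+c<uv)
        x , ux , xv = geodesic-vertex u v c (d u v ∸ c) (m+[n∸m]≡n c≤uv)
        c<xv : c < d x v
        c<xv = subst (c <_) (sym xv) (+-cancelˡ-< c c _ (subst (c + c <_) (sym (m+[n∸m]≡n c≤uv)) c+c<uv))
    in <-irrefl ux (dist<closerCount (subst₂ _<_ (sym ux) (dist-sym x v) c<xv))
    where c = closerCount u v

  closerCount+closerCount≤resolvingCount : ∀ u v → closerCount u v + closerCount v u ≤ resolvingCount u v
  closerCount+closerCount≤resolvingCount u v = length-filter-disjoint-+ _ _ _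
    <⇒≯ <⇒≢ (λ vw<uw uw≡vw → <⇒≢ vw<uw (sym uw≡vw)) (allFin n)

  resolvingCount-sym : ∀ u v → resolvingCount u v ≡ resolvingCount v u
  resolvingCount-sym u v = ≤-antisym (length-filter-mono _ _ (_∘ sym) (allFin n))
                                     (length-filter-mono _ _ (_∘ sym) (allFin n))

  dist≤resolvingCount : ∀ u v → d u v ≤ resolvingCount u v
  dist≤resolvingCount u v = ≮⇒≥ λ K<uv → <⇒≱ (+-mono-< K<uv K<uv) (begin
    d u v + d u v                           ≡⟨ cong (λ k → d u v + k) (dist-sym u v) ⟩
    d u v + d v u                           ≤⟨ +-mono-≤ (dist≤closerCount+closerCount u v)
                                                        (dist≤closerCount+closerCount v u) ⟩
    (c₁ + c₁) + (c₂ + c₂)                   ≡⟨ +-interchange c₁ c₁ c₂ c₂ ⟩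
    (c₁ + c₂) + (c₁ + c₂)                   ≤⟨ +-mono-≤ (closerCount+closerCount≤resolvingCount u v)
                                                        (closerCount+closerCount≤resolvingCount u v) ⟩
    resolvingCount u v + resolvingCount u v ∎)
    where
    c₁ = closerCount u v
    c₂ = closerCount v u
    open ≤-Reasoning

  resolving-dist-≤-twice-resolvingCount : ∀ {u v w} → d u w ≢ d v w →
                                          d u w ≤ resolvingCount u v + resolvingCount u v
  resolving-dist-≤-twice-resolvingCount {u} {v} {w} uw≢vw with <-cmp (d u w) (d v w)
  ... | tri< uw<vw _ _ = ≤-trans (<⇒≤ (<-≤-trans (dist<closerCount uw<vw)
                                   (≤-trans (m≤m+n _ _) (closerCount+closerCount≤resolvingCount u v))))
                                 (m≤m+n _ _)
  ... | tri≈ _ uw≡vw _ = contradiction uw≡vw uw≢vw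
  ... | tri> _ _ vw<uw = ≤-trans (dist-triangle u v w) (+-mono-≤ (dist≤resolvingCount u v)
          (<⇒≤ (<-≤-trans (dist<closerCount vw<uw)
                  (≤-trans (m≤n+m _ _) (closerCount+closerCount≤resolvingCount u v)))))

  dist-agree-beyond-twice-resolvingCount : ∀ {u v w} → let K = resolvingCount u v in
                                           K + K < d u w ⊎ K + K < d v w → d u w ≡ d v w
  dist-agree-beyond-twice-resolvingCount {u} {v} {w} far =
    decidable-stable (d u w ≟ d v w) λ uw≢vw → case far of λ
      { (inj₁ far-u) → <⇒≱ far-u (resolving-dist-≤-twice-resolvingCount uw≢vw)
      ; (inj₂ far-v) → <⇒≱ far-v (subst (λ K → d v w ≤ K + K) (resolvingCount-sym v u)
                                   (resolving-dist-≤-twice-resolvingCount (uw≢vw ∘ sym)))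
      }

  boundary-transfer : ∀ {m a b w} → (∀ {x} → m ≤ d a x → d a x ≡ d b x) →
                      InBoundary G a m w → InBoundary G b m w
  boundary-transfer {m} agree (aw≡m , y , m<ay , wy≡1) =
    trans (sym (agree (≤-reflexive (sym aw≡m)))) aw≡m , y , subst (m <_) (agree (<⇒≤ m<ay)) m<ay , wy≡1

  equalBoundary-of-agreement : ∀ {m u v z} → u ≢ v →
    (∀ {w} → m ≤ d u w ⊎ m ≤ d v w → d u w ≡ d v w) → m < d u z → EqualBoundary G m u v
  equalBoundary-of-agreement u≢v agree m<uz =
    u≢v , (λ w → boundary-transfer (agree ∘ inj₁) , boundary-transfer (sym ∘ agree ∘ inj₂)) ,
    map₂ proj₁ (boundary-vertex-towards m<uz)

  etaPair≤resolvingCount : ∀ m u v → etaPair G m u v ≤ resolvingCount u v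
  etaPair≤resolvingCount m u v = length-filter-mono _ _ proj₂ (allFin n)

  resolvingCount≤resolvers-⊤ : ∀ u v → resolvingCount u v ≤ resolvers G ⊤ u v
  resolvingCount≤resolvers-⊤ u v = length-filter-mono _ _ (∈⊤ ,_) (allFin n)

  resolvingCount-≥-eta : ∀ {e} →
                         (∀ m v v′ → 1 ≤ m → EqualBoundary G m v v′ → e ≤ etaPair G m v v′) →
                         e * 4 + 2 ≤ diam G → ∀ {u v} → u ≢ v → e ≤ resolvingCount u v
  resolvingCount-≥-eta {e} η-min 4e+2≤diam {u} {v} u≢v
    with any? (λ z → suc (K + K) <? d u z)
    where K = resolvingCount u v
  ... | yes (z , far) = ≤-trans (η-min _ u v (s≤s z≤n)
          (equalBoundary-of-agreement u≢v dist-agree-beyond-twice-resolvingCount far))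
          (etaPair≤resolvingCount _ u v)
  ... | no ¬far = m*4+2≤[1+n+n]+[1+n+n]⇒m≤n
          (≤-trans 4e+2≤diam (diam-≤-eccentricity (λ x → ≮⇒≥ (¬far ∘ (x ,_)))))

-- The hypothesis 𝒩_m(G) ≠ ∅ is already part of IsEta G e.
theorem2p8 : ∀ (n : ℕ) (G : Graph n) → Connected G
    → (∃ λ m → 1 ≤ m × NmNonempty G m)
    → ∀ (e : ℕ) → IsEta G e
    → + e ≤ℤ ((+ diam G - + 2) /ℕ 4)
    → IsDim G e
theorem2p8 n G connected _ e ((_ , _ , v , v′ , ∂v≡∂v′ , ηvv′≡e) , η-min) e≤⌊diam-2⌋/4 =
  (⊤ , ⊤-generates) , no-larger-generator
  where
  open Distance G connected
  ⊤-generates : IsKMetricGenerator G e ⊤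
  ⊤-generates u w u≢w = ≤-trans
    (resolvingCount-≥-eta η-min (+m≤[+n-2]/4⇒m*4+2≤n (diam G) e≤⌊diam-2⌋/4) u≢w)
    (resolvingCount≤resolvers-⊤ u w)
  no-larger-generator : ∀ k → e < k → ¬ ∃ (IsKMetricGenerator G k)
  no-larger-generator k e<k (S , S-generates) =
    <⇒≱ e<k (subst (k ≤_) ηvv′≡e (generator-≤-etaPair ∂v≡∂v′ S-generates))
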